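{- Let $(X,\theta)$ be a commutation alphabet and $R\subseteq X\times\mathcal{S}(X,\theta)$ such that the alphabetic rewriting system $(\mathcal{S}(X,\theta),\Rightarrow_R)$ is convergent. If $X\neq\emptyset$, then $\mathsf{Irr}(X)\neq\emptyset$.
   Context: A commutation alphabet is a pair $(X,\theta)$ with $\theta\subseteq X\times X$ symmetric and irreflexive. $\mathcal{S}(X,\theta)=X^+/\equiv_\theta$, $\mathcal{M}(X,\theta)=X^*/\equiv_\theta$, where $\equiv_\theta$ is the congruence generated by $(xy,yx)$, $(x,y)\in\theta$; $X$ is identified with its image in $\mathcal{S}(X,\theta)$. $w\Rightarrow_R w'$ iff $w=uav$, $w'=ubv$ for some $u,v\in\mathcal{M}(X,\theta)$, $(a,b)\in R$. Convergent means terminating (no infinite $\Rightarrow_R$-chain) and confluent. $\mathsf{Irr}(X)$ is the set of letters $x\in X$ that are irreducible, i.e. there is no $w'$ with $x\Rightarrow_R w'$ (equivalently, no $w$ with $(x,w)\in R$). -}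

module Defs where

open import Data.List using (List; []; _∷_; _++_; [_])
open import Data.Product using (Σ; ∃; _×_; _,_)
open import Relation.Binary.PropositionalEquality using (_≡_)
open import Relation.Nullary using (¬_)
open import Relation.Binary.Construct.Closure.ReflexiveTransitive using (Star)
open import Induction.WellFounded using (Acc)

record CommutationAlphabet : Set₁ where
  field
    X      : Set
    θ      : X → X → Set
    θ-sym  : ∀ {x y} → θ x y → θ y x
    θ-irr  : ∀ {x} → ¬ θ x x

module _ (A : CommutationAlphabet) where
  open CommutationAlphabet A

  -- The congruence ≡_θ on X* generated by xy = yx for (x,y) ∈ θ.
  -- Traces (elements of M(X,θ)) are represented by words, up to ≈θ.
  data _≈θ_ : List X → List X → Set where
    ≈-refl  : ∀ {w} → w ≈θ w
    ≈-sym   : ∀ {w w'} → w ≈θ w' → w' ≈θ w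
    ≈-trans : ∀ {w w' w''} → w ≈θ w' → w' ≈θ w'' → w ≈θ w''
    ≈-swap  : ∀ {x y} (u v : List X) → θ x y →
              (u ++ x ∷ y ∷ v) ≈θ (u ++ y ∷ x ∷ v)

  -- An alphabetic rule set R ⊆ X × S(X,θ): R x b with b a nonempty word
  -- (representing a trace of S(X,θ)).
  record AlphabeticRules : Set₁ where
    field
      R        : X → List X → Set
      R-nonempty : ∀ {x b} → R x b → ¬ b ≡ []

  module _ (Rs : AlphabeticRules) where
    open AlphabeticRules Rs

    _⇒_ : List X → List X → Set
    w ⇒ w' = Σ (List X) λ u → Σ (List X) λ v → Σ X λ a → Σ (List X) λ b →
               R a b × (w ≈θ (u ++ a ∷ v)) × (w' ≈θ (u ++ b ++ v))

    _⇒*_ : List X → List X → Set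
    _⇒*_ = Star _⇒_

    -- Terminating on S(X,θ): no infinite ⇒-chain, stated constructively as
    -- well-foundedness of the converse of ⇒ on nonempty traces.
    Terminating : Set
    Terminating = ∀ (w : List X) → ¬ w ≡ [] → Acc (λ w₁ w₂ → w₂ ⇒ w₁) w

    Confluent : Set
    Confluent = ∀ (w w₁ w₂ : List X) → ¬ w ≡ [] → w ⇒* w₁ → w ⇒* w₂ →
                Σ (List X) λ v₁ → Σ (List X) λ v₂ →
                  (w₁ ⇒* v₁) × (w₂ ⇒* v₂) × (v₁ ≈θ v₂)

    Convergent : Set
    Convergent = Terminating × Confluent

    Irr : X → Set
    Irr x = ¬ (Σ (List X) λ w' → [ x ] ⇒ w')

module Submission where

-- Suppose every letter x is reducible, i.e. [x] ⇒ w' for some w'.  Rewriting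
-- is compatible with right context, so a nonempty word y ∷ rest rewrites to
-- w' ++ rest, and w' ++ rest is again nonempty: the right-hand side of an
-- alphabetic rule is a nonempty word and trace equivalence preserves length.
-- Hence every nonempty word admits a step to a nonempty word, and well-founded
-- induction shows that no nonempty word is accessible for the converse of ⇒.
-- This contradicts termination at any one-letter word [x], which exists since
-- the alphabet is nonempty.

open import Defs
open import Data.Empty using (⊥)
open import Relation.Nullary using (¬_)
open import Data.List using (List; []; _∷_; _++_; [_]; length)
open import Data.List.Properties using (++-assoc; length-++; ++-conicalˡ; ++-conicalʳ)
open import Data.Product using (_,_)
open import Relation.Binary.PropositionalEquality using (_≡_; refl; sym; trans; cong; subst)
open import Induction.WellFounded using (Acc; acc)

module _ (A : CommutationAlphabet) where
  open CommutationAlphabet A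

  -- Trace equivalence only permutes letters, so it preserves word length.
  ≈θ-length : ∀ {w w'} → _≈θ_ A w w' → length w ≡ length w'
  ≈θ-length ≈-refl          = refl
  ≈θ-length (≈-sym p)       = sym (≈θ-length p)
  ≈θ-length (≈-trans p q)   = trans (≈θ-length p) (≈θ-length q)
  ≈θ-length (≈-swap u v _)  = trans (length-++ u) (sym (length-++ u))

  ≈θ-++ʳ : ∀ {w w'} (r : List X) → _≈θ_ A w w' → _≈θ_ A (w ++ r) (w' ++ r)
  ≈θ-++ʳ r ≈-refl        = ≈-refl
  ≈θ-++ʳ r (≈-sym p)     = ≈-sym (≈θ-++ʳ r p)
  ≈θ-++ʳ r (≈-trans p q) = ≈-trans (≈θ-++ʳ r p) (≈θ-++ʳ r q)
  ≈θ-++ʳ r (≈-swap {x} {y} u v t)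
    rewrite ++-assoc u (x ∷ y ∷ v) r | ++-assoc u (y ∷ x ∷ v) r = ≈-swap u (v ++ r) t

  length-zero : (w : List X) → length w ≡ 0 → w ≡ []
  length-zero [] _ = refl

  middle-nonempty : (u b v : List X) → ¬ b ≡ [] → ¬ u ++ b ++ v ≡ []
  middle-nonempty u b v b≢[] eq = b≢[] (++-conicalˡ b v (++-conicalʳ u (b ++ v) eq))

  module _ (Rs : AlphabeticRules A) where
    open AlphabeticRules Rs

    ⇒-++ʳ : ∀ {w w'} (r : List X) → _⇒_ A Rs w w' → _⇒_ A Rs (w ++ r) (w' ++ r)
    ⇒-++ʳ r (u , v , a , b , rule , w≈uav , w'≈ubv) =
      u , v ++ r , a , b , rule ,
      subst (_≈θ_ A _) (++-assoc u (a ∷ v) r) (≈θ-++ʳ r w≈uav) ,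
      subst (_≈θ_ A _) (trans (++-assoc u (b ++ v) r) (cong (u ++_) (++-assoc b v r)))
        (≈θ-++ʳ r w'≈ubv)

    -- Right-hand sides of alphabetic rules are nonempty, so every step
    -- produces a nonempty word.
    ⇒-nonempty : ∀ {w w'} → _⇒_ A Rs w w' → ¬ w' ≡ []
    ⇒-nonempty (u , v , a , b , rule , _ , w'≈ubv) refl =
      middle-nonempty u b v (R-nonempty rule)
        (length-zero (u ++ b ++ v) (sym (≈θ-length w'≈ubv)))

    -- If no letter is irreducible, every nonempty word has an infinite
    -- descending chain: rewrite its first letter and recurse.
    no-irreducible⇒¬Acc : (∀ x → ¬ Irr A Rs x) →
      ∀ w → ¬ w ≡ [] → ¬ Acc (λ w₁ w₂ → _⇒_ A Rs w₂ w₁) w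
    no-irreducible⇒¬Acc allReducible [] w≢[] _ = w≢[] refl
    no-irreducible⇒¬Acc allReducible (y ∷ rest) _ (acc descend) =
      allReducible y λ (w' , step) →
        no-irreducible⇒¬Acc allReducible (w' ++ rest)
          (λ eq → ⇒-nonempty step (++-conicalˡ w' rest eq))
          (descend (⇒-++ʳ rest step))

mainTheorem9 : (A : CommutationAlphabet) (Rs : AlphabeticRules A) →
    Convergent A Rs →
    ¬ (CommutationAlphabet.X A → ⊥) →
    ¬ (∀ (x : CommutationAlphabet.X A) → ¬ Irr A Rs x)
mainTheorem9 A Rs (terminating , _) nonemptyAlphabet allReducible =
  nonemptyAlphabet λ x →
    no-irreducible⇒¬Acc A Rs allReducible [ x ] (λ ()) (terminating [ x ] (λ ()))
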